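{- Let $G$ be a connected graph of order $n\geq 4$ and size $m\geq n$. If $G$ has a Hamiltonian path, then \[ m+1+\lfloor 2n/3 \rfloor \leq \chi_d^t(C(G))+ \chi_d^t(\overline{C(G)})\leq m+n+\lceil n/2 \rceil , \] and if $\Delta(G)\leq n-2$, then \[ m+1+\lfloor 2n/3 \rfloor \leq \chi_d^t(C(G))+ \chi_d^t(\overline{C(G)})\leq m+n+1 . \]
   Context: All graphs are finite, simple and undirected; the size is the number of edges, $\Delta$ denotes maximum degree and $\overline{H}$ the complement of $H$. For a graph $G=(V,E)$ with $V=\{v_1,\dots,v_n\}$, the central graph $C(G)$ is the graph with vertex set $V\cup\{c_{ij} : v_iv_j\in E\}$ obtained by subdividing each edge $v_iv_j$ of $G$ exactly once by a new vertex $c_{ij}$ (adjacent to exactly $v_i$ and $v_j$) and joining every pair of distinct vertices non-adjacent in $G$. A total dominator coloring (TDC) of a graph $H$ with no isolated vertices is a proper vertex coloring of $H$ in which every vertex is adjacent to all vertices of some color class. $\chi_d^t(H)$ is the minimum number of color classes in a TDC of $H$. -}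

module Defs where

open import Data.Nat using (ℕ; zero; suc; _+_; _≤_)
open import Data.Fin using (Fin; toℕ) renaming (_<_ to _<ᶠ_)
open import Data.Bool using (Bool; true; false; if_then_else_)
open import Data.List using (map; allFin)
open import Data.Nat.ListAction using (sum)
open import Data.Product using (Σ; ∃; _×_; _,_; proj₁; proj₂)
open import Data.Sum using (_⊎_; inj₁; inj₂)
open import Data.Empty using (⊥)
open import Relation.Nullary using (¬_)
open import Relation.Binary.PropositionalEquality using (_≡_; _≢_)
open import Function.Bundles using (_↔_)
open import Function.Definitions using (Injective)

record Graph (n : ℕ) : Set where
  field
    adj    : Fin n → Fin n → Bool
    adj-sym    : ∀ i j → adj i j ≡ adj j i
    adj-irrefl : ∀ i → adj i i ≡ false
open Graph public

Edge : ∀ {n} → Graph n → Set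
Edge {n} G = Σ (Fin n × Fin n) λ p → (proj₁ p <ᶠ proj₂ p) × (adj G (proj₁ p) (proj₂ p) ≡ true)

HasSize : ∀ {n} → Graph n → ℕ → Set
HasSize G m = Fin m ↔ Edge G

data Reach {n} (G : Graph n) : Fin n → Fin n → Set where
  here : ∀ {i} → Reach G i i
  step : ∀ {i j k} → adj G i j ≡ true → Reach G j k → Reach G i k

Connected : ∀ {n} → Graph n → Set
Connected {n} G = ∀ (i j : Fin n) → Reach G i j

-- Hamiltonian path: an ordering p 0, ..., p (n-1) of all vertices
-- (injective, hence bijective on Fin n) with consecutive vertices adjacent.
HamPath : ∀ {n} → Graph n → Set
HamPath {n} G = Σ (Fin n → Fin n) λ p →
  Injective _≡_ _≡_ p ×
  (∀ (i j : Fin n) → toℕ j ≡ suc (toℕ i) → adj G (p i) (p j) ≡ true)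

degree : ∀ {n} → Graph n → Fin n → ℕ
degree {n} G v = sum (map (λ u → if adj G v u then 1 else 0) (allFin n))

MaxDegreeAtMost : ∀ {n} → Graph n → ℕ → Set
MaxDegreeAtMost {n} G d = ∀ (v : Fin n) → degree G v ≤ d

-- Central graph C(G): vertices are the original vertices plus one
-- subdivision vertex per edge.
CVertex : ∀ {n} → Graph n → Set
CVertex {n} G = Fin n ⊎ Edge G

CAdj : ∀ {n} (G : Graph n) → CVertex G → CVertex G → Set
CAdj G (inj₁ i) (inj₁ j) = (i ≢ j) × (adj G i j ≡ false)
CAdj G (inj₁ i) (inj₂ ((a , b) , _)) = (i ≡ a) ⊎ (i ≡ b)
CAdj G (inj₂ ((a , b) , _)) (inj₁ i) = (i ≡ a) ⊎ (i ≡ b)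
CAdj G (inj₂ _) (inj₂ _) = ⊥

Compl : ∀ {V : Set} → (V → V → Set) → V → V → Set
Compl R u v = (u ≢ v) × ¬ R u v

-- Total dominator coloring with exactly k (nonempty) color classes:
-- c is surjective onto Fin k, proper, and every vertex is adjacent to
-- every vertex of some color class.
IsTDC : ∀ {V : Set} → (V → V → Set) → (k : ℕ) → (V → Fin k) → Set
IsTDC {V} R k c =
  (∀ (j : Fin k) → ∃ λ (u : V) → c u ≡ j) ×
  (∀ (u v : V) → R u v → c u ≢ c v) ×
  (∀ (v : V) → ∃ λ (j : Fin k) → ∀ (u : V) → c u ≡ j → R v u)

HasTDC : ∀ {V : Set} → (V → V → Set) → ℕ → Set
HasTDC {V} R k = Σ (V → Fin k) (IsTDC R k)

IsTDChromaticNumber : ∀ {V : Set} → (V → V → Set) → ℕ → Set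
IsTDChromaticNumber R k = HasTDC R k × (∀ k′ → HasTDC R k′ → k ≤ k′)

-- The subdivision vertices form a clique in the complement of C(G), so b ≥ m. In C(G) the
-- subdivision vertex of an edge xz must dominate a colour class, which therefore lies inside {x, z}. Hence a
-- colour shared by two path vertices is carried by nothing else, and of two consecutive path vertices with
-- different colours one is alone in its class. For each colour repeated along the Hamiltonian path, its two
-- occurrences and the (lonely) position right after the later one are three private positions among 0, …, n;
-- counting these against the first occurrences of colours gives 3a ≥ 2n - 1. The colour of a subdivision
-- vertex is either absent from the path or held by a single path vertex that is not alone in its class (and is
-- again followed by a lonely one); either way the count improves to 3a ≥ 2n + 1, i.e. a > ⌊2n/3⌋.
--
-- Since m ≥ n the path has a chord, and following the path towards the chord gives a map g
-- with v ~ g(v) and g(g(v)) ≠ v; colouring each edge by itself and each vertex v like the edge v g(v) is a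
-- total dominator colouring of the complement with m colours. In C(G), give the vertices their own colours
-- except that the ends of one edge share one, give each edge of an edge cover (⌈n/2⌉ path edges) its own
-- colour and all other edges the freed colour. If Δ ≤ n - 2, every vertex has a non-neighbour, and the n
-- vertex colours plus one colour for all edges suffice.

module Submission where

open import Defs
open import Axiom.UniquenessOfIdentityProofs using (module Decidable⇒UIP)
open import Data.Bool using (true; false; if_then_else_)
import Data.Bool.Properties as Bool
open import Data.Fin using (Fin; zero; suc; toℕ; fromℕ<; inject₁; punchOut; join; splitAt) renaming (_<_ to _<ᶠ_)
open import Data.Fin.Properties
  using (_≟_; _<?_; any?; all?; ¬∀⟶∃¬; <-cmp; <⇒≢; <-trans; injective⇒≤; punchOut-injective; splitAt-join;
         toℕ<n; toℕ-fromℕ<; toℕ-injective; toℕ-inject₁; inject₁-injective; suc-injective)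
open import Data.List using (List; []; _∷_; length; lookup; map; filter; allFin; tabulate; _++_)
open import Data.List.Properties using (length-++; length-map; length-tabulate; map-tabulate)
open import Data.List.Membership.Propositional.Properties using (∈-lookup; ∈-map⁻)
open import Data.List.Relation.Binary.Disjoint.Propositional using (Disjoint)
open import Data.List.Relation.Unary.All as All using (All; []; _∷_)
open import Data.List.Relation.Unary.All.Properties as All using (all-filter)
open import Data.List.Relation.Unary.AllPairs using ([]; _∷_)
open import Data.List.Relation.Unary.Unique.Propositional using (Unique)
import Data.List.Relation.Unary.Unique.Propositional.Properties as Unique
open import Data.Nat using (ℕ; zero; suc; pred; _+_; _*_; _∸_; _≤_; _<_; _⊓_; z≤n; s≤s; s≤s⁻¹; ⌊_/2⌋; ⌈_/2⌉)
import Data.Nat.Properties as ℕ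
open import Data.Nat.DivMod using (_/_; m/n≡1+[m∸n]/n; m<n*o⇒m/o<n)
open import Data.Nat.ListAction using (sum)
open import Data.Nat.Tactic.RingSolver using (solve-∀)
open import Data.Product using (Σ; ∃; ∃₂; _×_; _,_; proj₁; proj₂)
import Data.Product.Properties as Product
open import Data.Sum as Sum using (_⊎_; inj₁; inj₂)
open import Data.Sum.Properties using (inj₁-injective; inj₂-injective)
open import Function using (_∘_)
open import Function.Bundles using (Inverse; Injection)
open import Function.Definitions using (Injective)
open import Function.Properties.Inverse using (↔⇒↣)
open import Relation.Binary using (DecidableEquality; Tri; tri<; tri≈; tri>)
open import Relation.Binary.PropositionalEquality
open import Relation.Nullary using (¬_; Dec; yes; no; ¬?; _×-dec_; _⊎-dec_; contradiction; map′)
open import Relation.Nullary.Decidable using (decidable-stable)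
open import Relation.Unary using (Decidable)

-- Counting

module _ {A : Set} where

  lookup-injective : ∀ {xs : List A} → Unique xs → ∀ i j → lookup xs i ≡ lookup xs j → i ≡ j
  lookup-injective (_ ∷ _) zero zero _ = refl
  lookup-injective {_ ∷ xs} (x∉xs ∷ _) zero (suc j) eq =
    contradiction eq (All.lookup x∉xs (∈-lookup {xs = xs} j))
  lookup-injective {_ ∷ xs} (x∉xs ∷ _) (suc i) zero eq =
    contradiction (sym eq) (All.lookup x∉xs (∈-lookup {xs = xs} i))
  lookup-injective (_ ∷ u) (suc i) (suc j) eq = cong suc (lookup-injective u i j eq)

  map⁺-on : ∀ {B : Set} {P : A → Set} {f : A → B} {xs} →
    (∀ {x y} → P x → P y → f x ≡ f y → x ≡ y) → All P xs → Unique xs → Unique (map f xs)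
  map⁺-on inj [] [] = []
  map⁺-on inj (px ∷ pxs) (x∉xs ∷ u) =
    All.map⁺ (All.zipWith (λ (x≢y , py) fx≡fy → x≢y (inj px py fx≡fy)) (x∉xs , pxs)) ∷ map⁺-on inj pxs u

  disjoint-by : ∀ {P : A → Set} {xs ys} → All P xs → All (¬_ ∘ P) ys → Disjoint xs ys
  disjoint-by ps ¬ps (v∈xs , v∈ys) = All.lookup ¬ps v∈ys (All.lookup ps v∈xs)

  length-filter-split : ∀ {P : A → Set} (P? : Decidable P) xs →
    length (filter P? xs) + length (filter (¬? ∘ P?) xs) ≡ length xs
  length-filter-split P? [] = refl
  length-filter-split P? (x ∷ xs) with P? x
  ... | yes _ = cong suc (length-filter-split P? xs)
  ... | no _ = trans (ℕ.+-suc _ _) (cong suc (length-filter-split P? xs))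

Unique⇒length≤ : ∀ {N} {xs : List (Fin N)} → Unique xs → length xs ≤ N
Unique⇒length≤ u = injective⇒≤ (λ {i} {j} → lookup-injective u i j)

injective⇒surjective : ∀ {n} {f : Fin n → Fin n} → Injective _≡_ _≡_ f → ∀ v → ∃ λ k → f k ≡ v
injective⇒surjective {suc n} {f} f-inj v with any? (λ k → f k ≟ v)
... | yes hit = hit
... | no miss = contradiction (injective⇒≤ punchOut-inj) (ℕ.<-irrefl refl)
  where
  v≢f : ∀ k → v ≢ f k
  v≢f k v≡fk = miss (k , sym v≡fk)
  punchOut-inj : Injective _≡_ _≡_ (λ k → punchOut (v≢f k))
  punchOut-inj eq = f-inj (punchOut-injective (v≢f _) (v≢f _) eq)

-- Total dominator colourings

Searchable : Set → Set₁
Searchable V = ∀ {P : V → Set} → Decidable P → Dec (∃ P)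

-- Unlike IsTDC, not every colour has to be used; a dominated class is named by one of its members.
record IsTDColouring {V C : Set} (R : V → V → Set) (c : V → C) : Set where
  field
    proper     : ∀ u v → R u v → c u ≢ c v
    dominating : ∀ v → ∃ λ w → ∀ u → c u ≡ c w → R v u
open IsTDColouring

relabel : ∀ {V C D : Set} {R : V → V → Set} {c : V → C} {f : C → D} →
  Injective _≡_ _≡_ f → IsTDColouring R c → IsTDColouring R (f ∘ c)
relabel f-inj tdc .proper u v r = proper tdc u v r ∘ f-inj
relabel f-inj tdc .dominating v with dominating tdc v
... | w , dom = w , λ u → dom u ∘ f-inj

join-injective : ∀ m n → Injective _≡_ _≡_ (join m n)
join-injective m n {i} {j} eq = trans (sym (splitAt-join m n i)) (trans (cong (splitAt m) eq) (splitAt-join m n j))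

punchOut-colouring : ∀ {V : Set} {R : V → V → Set} {K} {j : Fin (suc K)} (c : V → Fin (suc K)) →
  (∀ u → c u ≢ j) → IsTDColouring R c → Σ (V → Fin K) (IsTDColouring R)
punchOut-colouring {V} {R} {K} {j} c unused tdc = c′ , tdc′
  where
  c′ : V → Fin K
  c′ u = punchOut {i = j} λ j≡cu → unused u (sym j≡cu)
  tdc′ : IsTDColouring R c′
  tdc′ .proper u v r = proper tdc u v r ∘ punchOut-injective {i = j} _ _
  tdc′ .dominating v with dominating tdc v
  ... | w , dom = w , λ u → dom u ∘ punchOut-injective {i = j} _ _

IsTDColouring⇒HasTDC : ∀ {V : Set} {R : V → V → Set} {K} → Searchable V → (c : V → Fin K) → IsTDColouring R c →
  ∃ λ k → k ≤ K × HasTDC R k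
IsTDColouring⇒HasTDC {K = K} search c tdc with all? (λ j → search (λ u → c u ≟ j))
... | yes onto = K , ℕ.≤-refl , c , onto , proper tdc , λ v → let w , d = dominating tdc v in c w , d
IsTDColouring⇒HasTDC {K = zero} search c tdc | no ¬onto = contradiction (λ ()) ¬onto
IsTDColouring⇒HasTDC {K = suc K} search c tdc | no ¬onto with ¬∀⟶∃¬ _ _ (λ j → search (λ u → c u ≟ j)) ¬onto
... | j , unused with punchOut-colouring c (λ u cu≡j → unused (u , cu≡j)) tdc
...   | c′ , tdc′ with IsTDColouring⇒HasTDC search c′ tdc′
...     | k , k≤K , t = k , ℕ.m≤n⇒m≤1+n k≤K , t

χ≤ : ∀ {V : Set} {R : V → V → Set} {a K} → Searchable V → IsTDChromaticNumber R a →
  (c : V → Fin K) → IsTDColouring R c → a ≤ K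
χ≤ search (_ , minimal) c tdc with IsTDColouring⇒HasTDC search c tdc
... | k , k≤K , t = ℕ.≤-trans (minimal k t) k≤K

-- Edges and Hamiltonian paths

true≢false : true ≢ false
true≢false ()

module Edges {n : ℕ} (G : Graph n) where

  _∈ₑ_ : Fin n → Edge G → Set
  v ∈ₑ e = v ≡ proj₁ (proj₁ e) ⊎ v ≡ proj₂ (proj₁ e)

  _∈ₑ?_ : ∀ v e → Dec (v ∈ₑ e)
  v ∈ₑ? e = (v ≟ _) ⊎-dec (v ≟ _)

  adj⇒≢ : ∀ {x z} → adj G x z ≡ true → x ≢ z
  adj⇒≢ {x} xz refl = true≢false (trans (sym xz) (adj-irrefl G x))

  edge : ∀ {x z} → adj G x z ≡ true → Edge G
  edge {x} {z} xz with <-cmp x z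
  ... | tri< x<z _ _ = (x , z) , x<z , xz
  ... | tri≈ _ x≡z _ = contradiction x≡z (adj⇒≢ xz)
  ... | tri> _ _ z<x = (z , x) , z<x , trans (adj-sym G z x) xz

  ∈-edge⁻ : ∀ {x z v} (xz : adj G x z ≡ true) → v ∈ₑ edge xz → v ≡ x ⊎ v ≡ z
  ∈-edge⁻ {x} {z} xz v∈ with <-cmp x z
  ... | tri< _ _ _ = v∈
  ... | tri≈ _ x≡z _ = contradiction x≡z (adj⇒≢ xz)
  ... | tri> _ _ _ = Sum.swap v∈

  ∈-edgeˡ : ∀ {x z} (xz : adj G x z ≡ true) → x ∈ₑ edge xz
  ∈-edgeˡ {x} {z} xz with <-cmp x z
  ... | tri< _ _ _ = inj₁ refl
  ... | tri≈ _ x≡z _ = contradiction x≡z (adj⇒≢ xz)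
  ... | tri> _ _ _ = inj₂ refl

  ∈-edgeʳ : ∀ {x z} (xz : adj G x z ≡ true) → z ∈ₑ edge xz
  ∈-edgeʳ {x} {z} xz with <-cmp x z
  ... | tri< _ _ _ = inj₂ refl
  ... | tri≈ _ x≡z _ = contradiction x≡z (adj⇒≢ xz)
  ... | tri> _ _ _ = inj₁ refl

  ends-adjacent : ∀ {x y} (e : Edge G) → x ∈ₑ e → y ∈ₑ e → x ≢ y → adj G x y ≡ true
  ends-adjacent (_ , _ , h) (inj₁ refl) (inj₂ refl) _ = h
  ends-adjacent (_ , _ , h) (inj₂ refl) (inj₁ refl) _ = trans (adj-sym G _ _) h
  ends-adjacent _ (inj₁ refl) (inj₁ refl) x≢y = contradiction refl x≢y
  ends-adjacent _ (inj₂ refl) (inj₂ refl) x≢y = contradiction refl x≢y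

  edge-≡ : ∀ {e e′ : Edge G} → proj₁ e ≡ proj₁ e′ → e ≡ e′
  edge-≡ {_ , lt , h} {_ , lt′ , h′} refl =
    cong₂ (λ lt h → _ , lt , h) (ℕ.<-irrelevant lt lt′) (Decidable⇒UIP.≡-irrelevant Bool._≟_ h h′)

  _≟ₑ_ : DecidableEquality (Edge G)
  e ≟ₑ e′ = map′ edge-≡ (cong proj₁) (Product.≡-dec _≟_ _≟_ (proj₁ e) (proj₁ e′))

  ends-sorted : ∀ {x y} (e : Edge G) → x <ᶠ y → x ∈ₑ e → y ∈ₑ e → proj₁ e ≡ (x , y)
  ends-sorted _ x<y (inj₁ refl) (inj₂ refl) = refl
  ends-sorted _ x<y (inj₁ refl) (inj₁ refl) = contradiction x<y (ℕ.<-irrefl refl)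
  ends-sorted _ x<y (inj₂ refl) (inj₂ refl) = contradiction x<y (ℕ.<-irrefl refl)
  ends-sorted (_ , a<b , _) x<y (inj₂ refl) (inj₁ refl) = contradiction a<b (ℕ.<-asym x<y)

  edge-unique : ∀ {x y} {e e′ : Edge G} → x ≢ y → x ∈ₑ e → y ∈ₑ e → x ∈ₑ e′ → y ∈ₑ e′ → e ≡ e′
  edge-unique {x} {y} {e} {e′} x≢y x∈e y∈e x∈e′ y∈e′ with <-cmp x y
  ... | tri< x<y _ _ = edge-≡ (trans (ends-sorted e x<y x∈e y∈e) (sym (ends-sorted e′ x<y x∈e′ y∈e′)))
  ... | tri≈ _ x≡y _ = contradiction x≡y x≢y
  ... | tri> _ _ y<x = edge-≡ (trans (ends-sorted e y<x y∈e x∈e) (sym (ends-sorted e′ y<x y∈e′ x∈e′)))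

  searchable : ∀ {m} → HasSize G m → Searchable (CVertex G)
  searchable size {P} P? with any? (P? ∘ inj₁) | any? (P? ∘ inj₂ ∘ Inverse.to size)
  ... | yes (v , pv) | _ = yes (inj₁ v , pv)
  ... | no _ | yes (i , pe) = yes (inj₂ (Inverse.to size i) , pe)
  ... | no ¬v | no ¬e = no λ where
    (inj₁ v , pv) → ¬v (v , pv)
    (inj₂ e , pe) → ¬e (Inverse.from size e , subst (P ∘ inj₂) (sym (Inverse.strictlyInverseˡ size e)) pe)

module HamiltonianPath {n : ℕ} (G : Graph n) (path : HamPath G) where

  open Edges G

  p : Fin n → Fin n
  p = proj₁ path

  p-injective : ∀ {i j} → p i ≡ p j → i ≡ j
  p-injective = proj₁ (proj₂ path)

  p-adj : ∀ k l → toℕ l ≡ suc (toℕ k) → adj G (p k) (p l) ≡ true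
  p-adj = proj₂ (proj₂ path)

  position : Fin n → Fin n
  position v = proj₁ (injective⇒surjective p-injective v)

  p-position : ∀ v → p (position v) ≡ v
  p-position v = proj₂ (injective⇒surjective p-injective v)

  position-p : ∀ k → position (p k) ≡ k
  position-p k = p-injective (p-position (p k))

  pathEdge : ∀ {k l} → toℕ l ≡ suc (toℕ k) → Edge G
  pathEdge {k} {l} l≡1+k = edge (p-adj k l l≡1+k)

  ∈-pathEdge⁻ : ∀ {k l w} (l≡1+k : toℕ l ≡ suc (toℕ k)) → w ∈ₑ pathEdge l≡1+k → w ≡ p k ⊎ w ≡ p l
  ∈-pathEdge⁻ {k} {l} l≡1+k = ∈-edge⁻ (p-adj k l l≡1+k)

  ∈-pathEdge : ∀ {k l q} (l≡1+k : toℕ l ≡ suc (toℕ k)) → q ≡ k ⊎ q ≡ l → p q ∈ₑ pathEdge l≡1+k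
  ∈-pathEdge {k} {l} l≡1+k (inj₁ refl) = ∈-edgeˡ (p-adj k l l≡1+k)
  ∈-pathEdge {k} {l} l≡1+k (inj₂ refl) = ∈-edgeʳ (p-adj k l l≡1+k)

  edgeAt : ∀ {l} → suc l < n → Edge G
  edgeAt l+1<n = pathEdge {fromℕ< (ℕ.<-trans (ℕ.n<1+n _) l+1<n)} {fromℕ< l+1<n}
                   (trans (toℕ-fromℕ< _) (cong suc (sym (toℕ-fromℕ< _))))

  ∈-edgeAt : ∀ {l q} (l+1<n : suc l < n) → toℕ q ≡ l ⊎ toℕ q ≡ suc l → p q ∈ₑ edgeAt l+1<n
  ∈-edgeAt {l} l+1<n (inj₁ q≡l) =
    ∈-pathEdge _ (inj₁ (toℕ-injective (trans q≡l (sym (toℕ-fromℕ< (ℕ.<-trans (ℕ.n<1+n l) l+1<n))))))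
  ∈-edgeAt l+1<n (inj₂ q≡1+l) = ∈-pathEdge _ (inj₂ (toℕ-injective (trans q≡1+l (sym (toℕ-fromℕ< l+1<n)))))

-- Lower bounds

-- Positions 0, …, n - 1 along a path coloured by col; Solo k stands for "the colour class of k is {k}".
module ColouredPath {n a : ℕ} (col : Fin n → Fin a) (Solo : Fin n → Set)
  (at-most-pairs : ∀ {i j k} → i ≢ j → col i ≡ col j → col k ≡ col i → k ≡ i ⊎ k ≡ j)
  (solo-alone : ∀ {j k} → Solo k → col j ≡ col k → j ≡ k)
  (steps : ∀ {k l} → toℕ l ≡ suc (toℕ k) → col k ≡ col l ⊎ Solo k ⊎ Solo l) where

  Twin : Fin n → Set
  Twin k = ∃ λ j → j <ᶠ k × col j ≡ col k

  twin? : Decidable Twin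
  twin? k = any? λ j → (j <? k) ×-dec (col j ≟ col k)

  Lone : Fin n → Set
  Lone k = ∀ j → col j ≡ col k → j ≡ k

  SoloAfter : Fin n → Set
  SoloAfter k = ∀ {l} → toℕ l ≡ suc (toℕ k) → Solo l

  <-suc : ∀ {k l : Fin n} → toℕ l ≡ suc (toℕ k) → k <ᶠ l
  <-suc l≡1+k = ℕ.≤-reflexive (sym l≡1+k)

  twin-¬lone : ∀ {k} → Twin k → ¬ Lone k
  twin-¬lone (j , j<k , j~k) lone = <⇒≢ j<k (lone j j~k)

  solo⇒lone : ∀ {k} → Solo k → Lone k
  solo⇒lone solo j = solo-alone solo

  partner : Fin n → Fin n
  partner k with twin? k
  ... | yes (j , _) = j
  ... | no _ = k

  partner-spec : ∀ {k} → Twin k → partner k <ᶠ k × col (partner k) ≡ col k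
  partner-spec {k} twin with twin? k
  ... | yes (_ , spec) = spec
  ... | no ¬twin = contradiction twin ¬twin

  partner-¬twin : ∀ {k} → Twin k → ¬ Twin (partner k)
  partner-¬twin twin (i , i<π , i~π) with partner-spec twin
  ... | π<k , π~k with at-most-pairs (<⇒≢ π<k) π~k i~π
  ...   | inj₁ i≡π = <⇒≢ i<π i≡π
  ...   | inj₂ i≡k = <⇒≢ (<-trans i<π π<k) i≡k

  partner-¬lone : ∀ {k} → Twin k → ¬ Lone (partner k)
  partner-¬lone twin lone with partner-spec twin
  ... | π<k , π~k = <⇒≢ π<k (sym (lone _ (sym π~k)))

  partner-injective : ∀ {k k′} → Twin k → Twin k′ → partner k ≡ partner k′ → k ≡ k′
  partner-injective twin twin′ π≡π′ with partner-spec twin | partner-spec twin′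
  ... | π<k , π~k | π′<k′ , π′~k′
    with at-most-pairs (<⇒≢ π<k) π~k (trans (sym π′~k′) (cong col (sym π≡π′)))
  ...   | inj₁ k′≡π = contradiction (trans (sym π≡π′) (sym k′≡π)) (<⇒≢ π′<k′)
  ...   | inj₂ k′≡k = sym k′≡k

  twin-soloAfter : ∀ {k} → Twin k → SoloAfter k
  twin-soloAfter twin {l} l≡1+k with steps l≡1+k
  ... | inj₂ (inj₁ solo) = contradiction (solo⇒lone solo) (twin-¬lone twin)
  ... | inj₂ (inj₂ solo) = solo
  ... | inj₁ k~l with partner-spec twin
  ...   | π<k , π~k with at-most-pairs (<⇒≢ π<k) π~k (trans (sym k~l) (sym π~k))
  ...     | inj₁ l≡π = contradiction l≡π (<⇒≢ (<-trans π<k (<-suc l≡1+k)) ∘ sym)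
  ...     | inj₂ l≡k = contradiction l≡k (<⇒≢ (<-suc l≡1+k) ∘ sym)

  lone-soloAfter : ∀ {k} → Lone k → ¬ Solo k → SoloAfter k
  lone-soloAfter lone ¬solo {l} l≡1+k with steps l≡1+k
  ... | inj₁ k~l = contradiction (lone l (sym k~l)) (<⇒≢ (<-suc l≡1+k) ∘ sym)
  ... | inj₂ (inj₁ solo) = contradiction solo ¬solo
  ... | inj₂ (inj₂ solo) = solo

  firsts-injective : ∀ {i j} → ¬ Twin i → ¬ Twin j → col i ≡ col j → i ≡ j
  firsts-injective {i} {j} ¬twin-i ¬twin-j i~j with <-cmp i j
  ... | tri< i<j _ _ = contradiction (i , i<j , i~j) ¬twin-j
  ... | tri≈ _ i≡j _ = i≡j
  ... | tri> _ _ j<i = contradiction (j , j<i , sym i~j) ¬twin-i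

  twins firsts : List (Fin n)
  twins = filter twin? (allFin n)
  firsts = filter (¬? ∘ twin?) (allFin n)

  twins+firsts : length twins + length firsts ≡ n
  twins+firsts = trans (length-filter-split twin? (allFin n)) (length-tabulate _)

  -- Non-solo positions and successors of SoloAfter positions occupy disjoint slots among 0, …, n.
  nonSolo+soloAfter≤ : ∀ {xs ys} → Unique xs → Unique ys → All (¬_ ∘ Solo) xs → All SoloAfter ys →
    length xs + length ys ≤ suc n
  nonSolo+soloAfter≤ {xs} {ys} uxs uys ¬solos afters =
    subst (_≤ suc n) (trans (length-++ (map inject₁ xs)) (cong₂ _+_ (length-map inject₁ xs) (length-map suc ys)))
      (Unique⇒length≤ (Unique.++⁺ (Unique.map⁺ inject₁-injective uxs) (Unique.map⁺ suc-injective uys) apart))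
    where
    apart : Disjoint (map inject₁ xs) (map suc ys)
    apart (v∈xs , v∈ys) with ∈-map⁻ inject₁ v∈xs | ∈-map⁻ suc v∈ys
    ... | x , x∈xs , refl | y , y∈ys , x≡1+y =
      All.lookup ¬solos x∈xs (All.lookup afters y∈ys (trans (sym (toℕ-inject₁ x)) (cong toℕ x≡1+y)))

  module _ {ws : List (Fin n)} (unique-ws : Unique ws) (lone-ws : All (λ w → Lone w × ¬ Solo w) ws) where

    all-twin : All Twin twins
    all-twin = all-filter twin? (allFin n)

    unique-twins : Unique twins
    unique-twins = Unique.filter⁺ twin? (Unique.allFin⁺ n)

    ws-¬twin : All (¬_ ∘ Twin) ws
    ws-¬twin = All.map (λ (lone , _) twin → twin-¬lone twin lone) lone-ws

    unique-nonSolos : Unique (twins ++ map partner twins ++ ws)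
    unique-nonSolos = Unique.++⁺ unique-twins
      (Unique.++⁺ (map⁺-on partner-injective all-twin unique-twins) unique-ws
        (disjoint-by {P = ¬_ ∘ Lone} (All.map⁺ (All.map partner-¬lone all-twin))
                                     (All.map (λ (lone , _) ¬lone → ¬lone lone) lone-ws)))
      (disjoint-by all-twin (All.++⁺ (All.map⁺ (All.map partner-¬twin all-twin)) ws-¬twin))

    all-nonSolo : All (¬_ ∘ Solo) (twins ++ map partner twins ++ ws)
    all-nonSolo = All.++⁺ (All.map (λ twin → twin-¬lone twin ∘ solo⇒lone) all-twin)
      (All.++⁺ (All.map⁺ (All.map (λ twin → partner-¬lone twin ∘ solo⇒lone) all-twin)) (All.map proj₂ lone-ws))

    all-soloAfter : All SoloAfter (twins ++ ws)
    all-soloAfter = All.++⁺ (All.map (λ twin {l} → twin-soloAfter twin {l}) all-twin)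
                      (All.map (λ (lone , ¬solo) {l} → lone-soloAfter lone ¬solo {l}) lone-ws)

    twins-bound : (length twins + (length twins + length ws)) + (length twins + length ws) ≤ suc n
    twins-bound = subst (_≤ suc n) lengths
      (nonSolo+soloAfter≤ unique-nonSolos (Unique.++⁺ unique-twins unique-ws (disjoint-by all-twin ws-¬twin))
        all-nonSolo all-soloAfter)
      where
      lengths : length (twins ++ map partner twins ++ ws) + length (twins ++ ws) ≡
                (length twins + (length twins + length ws)) + (length twins + length ws)
      lengths = cong₂ _+_
        (trans (length-++ twins) (cong (length twins +_)
          (trans (length-++ (map partner twins)) (cong (_+ length ws) (length-map partner twins)))))
        (length-++ twins)

  unique-firstColours : Unique (map col firsts)
  unique-firstColours = map⁺-on firsts-injective (all-filter (¬? ∘ twin?) (allFin n))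
                          (Unique.filter⁺ (¬? ∘ twin?) (Unique.allFin⁺ n))

  firsts≤ : length firsts ≤ a
  firsts≤ = subst (_≤ a) (length-map col firsts) (Unique⇒length≤ unique-firstColours)

  firsts< : ∀ {x} → (∀ k → col k ≢ x) → suc (length firsts) ≤ a
  firsts< {x} unused = subst (_≤ a) (cong suc (length-map col firsts))
    (Unique⇒length≤ (All.map⁺ (All.tabulate λ {k} _ → unused k ∘ sym) ∷ unique-firstColours))

  -- t twins, f first occurrences, w lone non-solo positions and s colours unused along the path
  count-arithmetic : ∀ {t f w s} → t + f ≡ n → (t + (t + w)) + (t + w) ≤ suc n → s + f ≤ a → 2 ≤ (w + w) + 3 * s →
    suc (2 * n) ≤ 3 * a
  count-arithmetic {t} {f} {w} {s} refl slots colours spare = ℕ.+-cancelʳ-≤ (w + w) _ _ (begin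
    suc (2 * (t + f)) + (w + w)     ≡⟨ e₁ t f w ⟩
    (t + t + (w + w)) + suc (f + f) ≤⟨ ℕ.+-monoˡ-≤ _ twice-t≤ ⟩
    suc f + suc (f + f)             ≡⟨ e₂ f ⟩
    2 + 3 * f                       ≤⟨ ℕ.+-monoˡ-≤ (3 * f) spare ⟩
    (w + w) + 3 * s + 3 * f         ≡⟨ e₃ f s w ⟩
    3 * (s + f) + (w + w)           ≤⟨ ℕ.+-monoˡ-≤ (w + w) (ℕ.*-monoʳ-≤ 3 colours) ⟩
    3 * a + (w + w)                 ∎)
    where
    open ℕ.≤-Reasoning
    e₀ : ∀ t w → (t + (t + w)) + (t + w) ≡ t + (t + t + (w + w))
    e₀ = solve-∀
    e₁ : ∀ t f w → suc (2 * (t + f)) + (w + w) ≡ (t + t + (w + w)) + suc (f + f)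
    e₁ = solve-∀
    e₂ : ∀ f → suc f + suc (f + f) ≡ 2 + 3 * f
    e₂ = solve-∀
    e₃ : ∀ f s w → (w + w) + 3 * s + 3 * f ≡ 3 * (s + f) + (w + w)
    e₃ = solve-∀
    twice-t≤ : t + t + (w + w) ≤ suc f
    twice-t≤ = ℕ.+-cancelˡ-≤ t _ _ (subst₂ _≤_ (e₀ t w) (sym (ℕ.+-suc t f)) slots)

  2n+1≤3a : (∃ λ x → ∀ k → col k ≢ x) ⊎ (∃ λ w → Lone w × ¬ Solo w) → suc (2 * n) ≤ 3 * a
  2n+1≤3a (inj₁ (x , unused)) =
    count-arithmetic {w = 0} {s = 1} twins+firsts (twins-bound [] []) (firsts< unused) (s≤s (s≤s z≤n))
  2n+1≤3a (inj₂ (w , lone-w)) =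
    count-arithmetic {w = 1} {s = 0} twins+firsts (twins-bound ([] ∷ []) (lone-w ∷ [])) firsts≤ ℕ.≤-refl

module CentralColouring {n a : ℕ} {G : Graph n} (c : CVertex G → Fin a) (tdc : IsTDC (CAdj G) a c) where

  open Edges G

  ClassWithin : CVertex G → Edge G → Set
  ClassWithin u₀ e = ∀ u → c u ≡ c u₀ → ∃ λ v → u ≡ inj₁ v × v ∈ₑ e

  subdivision-neighbour : ∀ {e} u → CAdj G (inj₂ e) u → ∃ λ v → u ≡ inj₁ v × v ∈ₑ e
  subdivision-neighbour (inj₁ v) v∈e = v , refl , v∈e

  endsClass : ∀ e → ∃ λ u₀ → ClassWithin u₀ e
  endsClass e with proj₂ (proj₂ tdc) (inj₂ e)
  ... | j , dom with proj₁ tdc j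
  ...   | u₀ , cu₀≡j = u₀ , λ u cu≡cu₀ → subdivision-neighbour u (dom u (trans cu≡cu₀ cu₀≡j))

  inj₁-end : ∀ {x z} {u : CVertex G} (xz : adj G x z ≡ true) →
    (∃ λ w → u ≡ inj₁ w × w ∈ₑ edge xz) → u ≡ inj₁ x ⊎ u ≡ inj₁ z
  inj₁-end xz (w , refl , w∈xz) = Sum.map (cong inj₁) (cong inj₁) (∈-edge⁻ xz w∈xz)

  class⊆ends : ∀ {x z} (xz : adj G x z ≡ true) → c (inj₁ x) ≡ c (inj₁ z) →
    ∀ u → c u ≡ c (inj₁ x) → u ≡ inj₁ x ⊎ u ≡ inj₁ z
  class⊆ends xz x~z u u~x with endsClass (edge xz)
  ... | u₀ , within with within u₀ refl
  ...   | v , refl , v∈xz with ∈-edge⁻ xz v∈xz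
  ...     | inj₁ refl = inj₁-end xz (within u u~x)
  ...     | inj₂ refl = inj₁-end xz (within u (trans u~x x~z))

  pair-class : ∀ {x z} → x ≢ z → c (inj₁ x) ≡ c (inj₁ z) → ∀ u → c u ≡ c (inj₁ x) → u ≡ inj₁ x ⊎ u ≡ inj₁ z
  pair-class x≢z x~z = class⊆ends (Bool.¬-not λ x≁z → proj₁ (proj₂ tdc) _ _ (x≢z , x≁z) x~z) x~z

  alone-at-end : ∀ {x z} {e : Edge G} → (∀ {w} → w ∈ₑ e → w ≡ x ⊎ w ≡ z) → c (inj₁ x) ≢ c (inj₁ z) →
    ClassWithin (inj₁ x) e → ∀ u → c u ≡ c (inj₁ x) → u ≡ inj₁ x
  alone-at-end ends x≁z within u u~x with within u u~x
  ... | w , refl , w∈e with ends w∈e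
  ...   | inj₁ refl = refl
  ...   | inj₂ refl = contradiction (sym u~x) x≁z

  module AlongPath (path : HamPath G) (e₀ : Edge G) where

    open HamiltonianPath G path

    col : Fin n → Fin a
    col k = c (inj₁ (p k))

    Solo : Fin n → Set
    Solo k = ∀ u → c u ≡ col k → u ≡ inj₁ (p k)

    at-most-pairs : ∀ {i j k} → i ≢ j → col i ≡ col j → col k ≡ col i → k ≡ i ⊎ k ≡ j
    at-most-pairs i≢j i~j k~i =
      Sum.map (p-injective ∘ inj₁-injective) (p-injective ∘ inj₁-injective)
        (pair-class (i≢j ∘ p-injective) i~j _ k~i)

    solo-alone : ∀ {j k} → Solo k → col j ≡ col k → j ≡ k
    solo-alone solo j~k = p-injective (inj₁-injective (solo _ j~k))

    steps : ∀ {k l} → toℕ l ≡ suc (toℕ k) → col k ≡ col l ⊎ Solo k ⊎ Solo l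
    steps {k} {l} l≡1+k with col k ≟ col l
    ... | yes k~l = inj₁ k~l
    ... | no k≁l with endsClass (pathEdge l≡1+k)
    ...   | u₀ , within with within u₀ refl
    ...     | v , refl , v∈kl with ∈-pathEdge⁻ l≡1+k v∈kl
    ...       | inj₁ refl = inj₂ (inj₁ (alone-at-end {e = pathEdge l≡1+k} (∈-pathEdge⁻ l≡1+k) k≁l within))
    ...       | inj₂ refl =
      inj₂ (inj₂ (alone-at-end {e = pathEdge l≡1+k} (Sum.swap ∘ ∈-pathEdge⁻ l≡1+k) (k≁l ∘ sym) within))

    open ColouredPath col Solo at-most-pairs solo-alone steps

    spare : (∃ λ x → ∀ k → col k ≢ x) ⊎ (∃ λ w → Lone w × ¬ Solo w)
    spare with any? (λ k → col k ≟ c (inj₂ e₀))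
    ... | no none = inj₁ (c (inj₂ e₀) , λ k k~e₀ → none (k , k~e₀))
    ... | yes (w , w~e₀) = inj₂ (w , lone , λ solo → contradiction (solo (inj₂ e₀) (sym w~e₀)) λ ())
      where
      lone : Lone w
      lone j j~w with j ≟ w
      ... | yes j≡w = j≡w
      ... | no j≢w = contradiction (pair-class (j≢w ∘ p-injective) j~w (inj₂ e₀) (trans (sym w~e₀) (sym j~w)))
                       λ { (inj₁ ()) ; (inj₂ ()) }

    bound : suc (2 * n) ≤ 3 * a
    bound = 2n+1≤3a spare

central-lower-bound : ∀ {n a} {G : Graph n} → HamPath G → Edge G → HasTDC (CAdj G) a → suc (2 * n) ≤ 3 * a
central-lower-bound path e₀ (c , tdc) = CentralColouring.AlongPath.bound c tdc path e₀

-- Subdivision vertices are pairwise adjacent in the complement.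
complement-lower-bound : ∀ {n m b} {G : Graph n} → HasSize G m → HasTDC (Compl (CAdj G)) b → m ≤ b
complement-lower-bound size (c , _ , proper , _) = injective⇒≤ colour-injective
  where
  open Injection (↔⇒↣ size)
  colour-injective : ∀ {i j} → c (inj₂ (to i)) ≡ c (inj₂ (to j)) → i ≡ j
  colour-injective {i} {j} same with i ≟ j
  ... | yes i≡j = i≡j
  ... | no i≢j = contradiction same (proper _ _ (i≢j ∘ injective ∘ inj₂-injective , λ ()))

-- Upper bounds

module ComplementColouring {n m : ℕ} {G : Graph n} (size : HasSize G m) (g : Fin n → Fin n)
  (g-adj : ∀ v → adj G v (g v) ≡ true) (g²≢id : ∀ v → g (g v) ≢ v) where

  open Edges G
  open Inverse size using (to; from; strictlyInverseˡ)

  out : Fin n → Edge G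
  out v = edge (g-adj v)

  out-injective : ∀ {x y} → out x ≡ out y → x ≡ y
  out-injective {x} {y} same
    with ∈-edge⁻ (g-adj y) (subst (x ∈ₑ_) same (∈-edgeˡ (g-adj x)))
       | ∈-edge⁻ (g-adj x) (subst (y ∈ₑ_) (sym same) (∈-edgeˡ (g-adj y)))
  ... | inj₁ x≡y | _ = x≡y
  ... | inj₂ _ | inj₁ y≡x = sym y≡x
  ... | inj₂ x≡gy | inj₂ y≡gx = contradiction (trans (cong g (sym y≡gx)) (sym x≡gy)) (g²≢id x)

  from-injective : ∀ {e e′} → from e ≡ from e′ → e ≡ e′
  from-injective {e} {e′} same = trans (sym (strictlyInverseˡ e)) (trans (cong to same) (strictlyInverseˡ e′))

  colour : CVertex G → Fin m
  colour (inj₁ v) = from (out v)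
  colour (inj₂ e) = from e

  class : ∀ {w} u → colour u ≡ colour (inj₁ w) → u ≡ inj₁ w ⊎ u ≡ inj₂ (out w)
  class (inj₁ z) same = inj₁ (cong inj₁ (out-injective (from-injective same)))
  class (inj₂ e) same = inj₂ (cong inj₂ (from-injective same))

  outside : ∀ e → ∃ λ w → ¬ w ∈ₑ e
  outside e@((x , y) , _) with g x ∈ₑ? e
  ... | no gx∉e = g x , gx∉e
  ... | yes (inj₁ gx≡x) = contradiction (sym gx≡x) (adj⇒≢ (g-adj x))
  ... | yes (inj₂ gx≡y) = g y , λ where
    (inj₁ gy≡x) → g²≢id x (trans (cong g gx≡y) gy≡x)
    (inj₂ gy≡y) → adj⇒≢ (g-adj y) (sym gy≡y)

  ∉-out-g : ∀ v → ¬ v ∈ₑ out (g v)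
  ∉-out-g v v∈ with ∈-edge⁻ (g-adj (g v)) v∈
  ... | inj₁ v≡gv = adj⇒≢ (g-adj v) v≡gv
  ... | inj₂ v≡ggv = g²≢id v (sym v≡ggv)

  tdc : IsTDColouring (Compl (CAdj G)) colour
  tdc .IsTDColouring.proper (inj₁ x) (inj₁ y) (x≢y , _) same = x≢y (cong inj₁ (out-injective (from-injective same)))
  tdc .IsTDColouring.proper (inj₁ x) (inj₂ e) (_ , x∉e) same =
    x∉e (subst (x ∈ₑ_) (from-injective same) (∈-edgeˡ (g-adj x)))
  tdc .IsTDColouring.proper (inj₂ e) (inj₁ x) (_ , x∉e) same =
    x∉e (subst (x ∈ₑ_) (from-injective (sym same)) (∈-edgeˡ (g-adj x)))
  tdc .IsTDColouring.proper (inj₂ e) (inj₂ e′) (e≢e′ , _) same = e≢e′ (cong inj₂ (from-injective same))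
  tdc .IsTDColouring.dominating (inj₁ v) = inj₁ (g v) , λ u same → dominated (class u same)
    where
    dominated : ∀ {u} → u ≡ inj₁ (g v) ⊎ u ≡ inj₂ (out (g v)) → Compl (CAdj G) (inj₁ v) u
    dominated (inj₁ refl) = adj⇒≢ (g-adj v) ∘ inj₁-injective , λ (_ , v≁gv) → true≢false (trans (sym (g-adj v)) v≁gv)
    dominated (inj₂ refl) = (λ ()) , ∉-out-g v
  tdc .IsTDColouring.dominating (inj₂ e) with outside e
  ... | w , w∉e = inj₁ w , λ u same → dominated (class u same)
    where
    dominated : ∀ {u} → u ≡ inj₁ w ⊎ u ≡ inj₂ (out w) → Compl (CAdj G) (inj₂ e) u
    dominated (inj₁ refl) = (λ ()) , w∉e
    dominated (inj₂ refl) = (λ e≡out → w∉e (subst (w ∈ₑ_) (sym (inj₂-injective e≡out)) (∈-edgeˡ (g-adj w)))) , λ ()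

-- From position k step towards i along the path; from i jump along the chord to j.
module Lollipop (i j : ℕ) (1+i<j : suc i < j) where

  next : ℕ → ℕ
  next k with ℕ.<-cmp k i
  ... | tri< _ _ _ = suc k
  ... | tri≈ _ _ _ = j
  ... | tri> _ _ _ = pred k

  next-below : ∀ {k} → k < i → next k ≡ suc k
  next-below {k} k<i with ℕ.<-cmp k i
  ... | tri< _ _ _ = refl
  ... | tri≈ _ k≡i _ = contradiction k≡i (ℕ.<⇒≢ k<i)
  ... | tri> _ _ i<k = contradiction k<i (ℕ.<⇒≯ i<k)

  next-at : next i ≡ j
  next-at with ℕ.<-cmp i i
  ... | tri< i<i _ _ = contradiction i<i (ℕ.<-irrefl refl)
  ... | tri≈ _ _ _ = refl
  ... | tri> _ _ i<i = contradiction i<i (ℕ.<-irrefl refl)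

  next-above : ∀ {k} → i < k → next k ≡ pred k
  next-above {k} i<k with ℕ.<-cmp k i
  ... | tri< k<i _ _ = contradiction k<i (ℕ.<⇒≯ i<k)
  ... | tri≈ _ k≡i _ = contradiction (sym k≡i) (ℕ.<⇒≢ i<k)
  ... | tri> _ _ _ = refl

  next-step : ∀ k → next k ≡ suc k ⊎ suc (next k) ≡ k ⊎ (k ≡ i × next k ≡ j)
  next-step k with ℕ.<-cmp k i
  ... | tri< _ _ _ = inj₁ refl
  ... | tri≈ _ k≡i _ = inj₂ (inj₂ (k≡i , refl))
  next-step (suc k) | tri> _ _ _ = inj₂ (inj₁ refl)

  next-< : ∀ {k n} → k < n → j < n → next k < n
  next-< {k} k<n j<n with ℕ.<-cmp k i
  ... | tri< k<i _ _ = ℕ.≤-<-trans k<i (ℕ.<-trans (ℕ.<-trans (ℕ.n<1+n i) 1+i<j) j<n)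
  ... | tri≈ _ _ _ = j<n
  ... | tri> _ _ _ = ℕ.≤-<-trans ℕ.pred[n]≤n k<n

  next-increasing : ∀ {k} → k ≤ i → k < next k
  next-increasing {k} k≤i with ℕ.m≤n⇒m<n∨m≡n k≤i
  ... | inj₁ k<i = ℕ.≤-reflexive (sym (next-below k<i))
  ... | inj₂ refl = subst (k <_) (sym next-at) (ℕ.<-trans (ℕ.n<1+n k) 1+i<j)

  next²≢id : ∀ k → next (next k) ≢ k
  next²≢id k = by-cases k (ℕ.<-cmp k i)
    where
    i<j : i < j
    i<j = ℕ.<-trans (ℕ.n<1+n i) 1+i<j
    by-cases : ∀ k → Tri (k < i) (k ≡ i) (i < k) → next (next k) ≢ k
    by-cases k (tri< k<i _ _) = ℕ.>⇒≢ (ℕ.<-trans (next-increasing (ℕ.<⇒≤ k<i))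
                                        (next-increasing (subst (_≤ i) (sym (next-below k<i)) k<i)))
    by-cases k (tri≈ _ refl _) =
      ℕ.>⇒≢ (subst (i <_) (sym (trans (cong next next-at) (next-above i<j))) (ℕ.<⇒≤pred 1+i<j))
    by-cases (suc k) (tri> _ _ i<1+k) with ℕ.m≤n⇒m<n∨m≡n (s≤s⁻¹ i<1+k)
    ... | inj₁ i<k = ℕ.<⇒≢ (ℕ.≤-<-trans ℕ.pred[n]≤n (ℕ.n<1+n k))
                     ∘ trans (sym (trans (cong next (next-above i<1+k)) (next-above i<k)))
    ... | inj₂ refl = ℕ.<⇒≢ 1+i<j ∘ sym ∘ trans (sym (trans (cong next (next-above i<1+k)) next-at))

module ChordedPath {n : ℕ} (G : Graph n) (path : HamPath G) where

  open Edges G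
  open HamiltonianPath G path

  Consecutive : Edge G → Set
  Consecutive e = ∃₂ λ k l → toℕ l ≡ suc (toℕ k) × p k ∈ₑ e × p l ∈ₑ e

  consecutive? : ∀ e → Dec (Consecutive e)
  consecutive? e = any? λ k → any? λ l → (toℕ l ℕ.≟ suc (toℕ k)) ×-dec (p k ∈ₑ? e) ×-dec (p l ∈ₑ? e)

  Chord : Set
  Chord = ∃₂ λ i j → suc (toℕ i) < toℕ j × adj G (p i) (p j) ≡ true

  chord-of : ∀ e → ¬ Consecutive e → Chord
  chord-of ((x , y) , x<y , xy) ¬cons with <-cmp (position x) (position y)
  ... | tri< a<b _ _ = position x , position y ,
          ℕ.≤∧≢⇒< a<b (λ 1+a≡b → ¬cons (_ , _ , sym 1+a≡b , inj₁ (p-position x) , inj₂ (p-position y))) ,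
          subst₂ (λ a b → adj G a b ≡ true) (sym (p-position x)) (sym (p-position y)) xy
  ... | tri≈ _ a≡b _ = contradiction (trans (sym (p-position x)) (trans (cong p a≡b) (p-position y))) (<⇒≢ x<y)
  ... | tri> _ _ b<a = position y , position x ,
          ℕ.≤∧≢⇒< b<a (λ 1+b≡a → ¬cons (_ , _ , sym 1+b≡a , inj₂ (p-position y) , inj₁ (p-position x))) ,
          subst₂ (λ a b → adj G a b ≡ true) (sym (p-position y)) (sym (p-position x)) (trans (adj-sym G y x) xy)

  -- An edge between consecutive positions is determined by its lower position, which is below n - 1.
  consecutive-edges≤ : ∀ {m} (size : HasSize G m) → (∀ i → Consecutive (Inverse.to size i)) → m ≤ pred n
  consecutive-edges≤ size cons = injective⇒≤ lower-injective
    where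
    open Inverse size using (to)
    open Injection (↔⇒↣ size) using (injective)
    lower : ∀ i → Fin (pred n)
    lower i with cons i
    ... | k , l , l≡1+k , _ = fromℕ< (ℕ.<⇒≤pred (subst (_< n) l≡1+k (toℕ<n l)))
    lower-injective : ∀ {i i′} → lower i ≡ lower i′ → i ≡ i′
    lower-injective {i} {i′} same with cons i | cons i′
    ... | k , l , l≡1+k , k∈ , l∈ | k′ , l′ , l′≡1+k′ , k′∈ , l′∈
      with toℕ-injective {i = k} {k′} (trans (sym (toℕ-fromℕ< _)) (trans (cong toℕ same) (toℕ-fromℕ< _)))
    ...   | refl with toℕ-injective {i = l} {l′} (trans l≡1+k (sym l′≡1+k′))
    ...     | refl =
      injective (edge-unique (ℕ.<⇒≢ (ℕ.≤-reflexive (sym l≡1+k)) ∘ cong toℕ ∘ p-injective) k∈ l∈ k′∈ l′∈)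

  chord : ∀ {m} → HasSize G m → 1 ≤ n → n ≤ m → Chord
  chord size 1≤n n≤m with any? (¬? ∘ consecutive? ∘ Inverse.to size)
  ... | yes (i , ¬cons) = chord-of (Inverse.to size i) ¬cons
  ... | no all-cons = contradiction (ℕ.≤-trans n≤m (consecutive-edges≤ size consecutive)) (n≰pred 1≤n)
    where
    consecutive : ∀ i → Consecutive (Inverse.to size i)
    consecutive i = decidable-stable (consecutive? (Inverse.to size i)) (all-cons ∘ (i ,_))
    n≰pred : ∀ {n} → 1 ≤ n → ¬ n ≤ pred n
    n≰pred (s≤s z≤n) = ℕ.<-irrefl refl

  module WithChord {i j : Fin n} (1+i<j : suc (toℕ i) < toℕ j) (ij : adj G (p i) (p j) ≡ true) where

    open Lollipop (toℕ i) (toℕ j) 1+i<j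

    advance : Fin n → Fin n
    advance k = fromℕ< (next-< (toℕ<n k) (toℕ<n j))

    toℕ-advance : ∀ k → toℕ (advance k) ≡ next (toℕ k)
    toℕ-advance k = toℕ-fromℕ< _

    advance-adj : ∀ k → adj G (p k) (p (advance k)) ≡ true
    advance-adj k with next-step (toℕ k)
    ... | inj₁ forward = p-adj k (advance k) (trans (toℕ-advance k) forward)
    ... | inj₂ (inj₁ backward) =
      trans (adj-sym G _ _) (p-adj (advance k) k (trans (sym backward) (cong suc (sym (toℕ-advance k)))))
    ... | inj₂ (inj₂ (k≡i , next≡j)) = subst₂ (λ a b → adj G (p a) (p b) ≡ true)
          (sym (toℕ-injective k≡i)) (sym (toℕ-injective (trans (toℕ-advance k) next≡j))) ij

    g : Fin n → Fin n
    g v = p (advance (position v))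

    g-adj : ∀ v → adj G v (g v) ≡ true
    g-adj v = subst (λ x → adj G x (g v) ≡ true) (p-position v) (advance-adj (position v))

    g²≢id : ∀ v → g (g v) ≢ v
    g²≢id v g²v≡v = next²≢id (toℕ k) (begin
      next (next (toℕ k))            ≡⟨ cong next (sym (toℕ-advance k)) ⟩
      next (toℕ (advance k))         ≡⟨ sym (toℕ-advance (advance k)) ⟩
      toℕ (advance (advance k))      ≡⟨ cong (toℕ ∘ advance) (sym (position-p (advance k))) ⟩
      toℕ (advance (position (g v))) ≡⟨ cong toℕ (sym (position-p _)) ⟩
      toℕ (position (g (g v)))       ≡⟨ cong (toℕ ∘ position) g²v≡v ⟩
      toℕ k                          ∎)
      where
      open ≡-Reasoning
      k = position v

complement-upper-bound : ∀ {n m b} {G : Graph n} → HasSize G m → HamPath G → 1 ≤ n → n ≤ m →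
  IsTDChromaticNumber (Compl (CAdj G)) b → b ≤ m
complement-upper-bound {G = G} size path 1≤n n≤m χ with ChordedPath.chord G path size 1≤n n≤m
... | i , j , 1+i<j , ij = χ≤ (Edges.searchable G size) χ colour tdc
  where
  open ChordedPath.WithChord G path 1+i<j ij
  open ComplementColouring size g g-adj g²≢id

-- x₀ and y₀ (the ends of e₀) share a colour, which frees the colour of y₀ for the edges outside the cover.
module CoverColouring {n k : ℕ} {G : Graph n} (ε : Fin k → Edge G) (covers : ∀ v → ∃ λ t → Edges._∈ₑ_ G v (ε t))
  (e₀ : Edge G) where

  open Edges G

  x₀ y₀ : Fin n
  x₀ = proj₁ (proj₁ e₀)
  y₀ = proj₂ (proj₁ e₀)

  merge : Fin n → Fin n
  merge v with v ≟ y₀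
  ... | yes _ = x₀
  ... | no _ = v

  merge≢y₀ : ∀ v → merge v ≢ y₀
  merge≢y₀ v with v ≟ y₀
  ... | yes _ = <⇒≢ (proj₁ (proj₂ e₀))
  ... | no v≢y₀ = v≢y₀

  merge-class : ∀ {v w} → merge w ≡ merge v → w ≡ v ⊎ (w ∈ₑ e₀ × v ∈ₑ e₀)
  merge-class {v} {w} same with w ≟ y₀ | v ≟ y₀
  ... | yes w≡y₀ | yes v≡y₀ = inj₁ (trans w≡y₀ (sym v≡y₀))
  ... | yes w≡y₀ | no _ = inj₂ (inj₂ w≡y₀ , inj₁ (sym same))
  ... | no _ | yes v≡y₀ = inj₂ (inj₁ same , inj₂ v≡y₀)
  ... | no _ | no _ = inj₁ same

  edgeColour : Edge G → Fin n ⊎ Fin k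
  edgeColour e with any? (λ t → ε t ≟ₑ e)
  ... | yes (t , _) = inj₂ t
  ... | no _ = inj₁ y₀

  edgeColour-inj₂ : ∀ {e t} → edgeColour e ≡ inj₂ t → ε t ≡ e
  edgeColour-inj₂ {e} e↦t with any? (λ t → ε t ≟ₑ e)
  ... | yes (_ , εs≡e) = subst (λ t → ε t ≡ e) (inj₂-injective e↦t) εs≡e

  edgeColour-cover : ∀ s → ∃ λ t → edgeColour (ε s) ≡ inj₂ t
  edgeColour-cover s with any? (λ t → ε t ≟ₑ ε s)
  ... | yes (t , _) = t , refl
  ... | no none = contradiction (s , refl) none

  edgeColour≢ : ∀ e v → edgeColour e ≢ inj₁ (merge v)
  edgeColour≢ e v with any? (λ t → ε t ≟ₑ e)
  ... | yes _ = λ ()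
  ... | no _ = merge≢y₀ v ∘ sym ∘ inj₁-injective

  colour : CVertex G → Fin n ⊎ Fin k
  colour (inj₁ v) = inj₁ (merge v)
  colour (inj₂ e) = edgeColour e

  vertex-class : ∀ {v} u → colour u ≡ inj₁ (merge v) → ∃ λ w → u ≡ inj₁ w × merge w ≡ merge v
  vertex-class (inj₁ w) same = w , refl , inj₁-injective same
  vertex-class {v} (inj₂ e) same = contradiction same (edgeColour≢ e v)

  end-class : ∀ {e z} → z ∈ₑ e → (z ∈ₑ e₀ → e₀ ≡ e) → ∀ u → colour u ≡ colour (inj₁ z) → CAdj G (inj₂ e) u
  end-class {z = z} z∈e merged u same with vertex-class {z} u same
  ... | w , refl , w~z with merge-class {z} {w} w~z
  ...   | inj₁ refl = z∈e
  ...   | inj₂ (w∈e₀ , z∈e₀) = subst (w ∈ₑ_) (merged z∈e₀) w∈e₀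

  tdc : IsTDColouring (CAdj G) colour
  tdc .IsTDColouring.proper (inj₁ x) (inj₁ y) (x≢y , x≁y) same with merge-class {x} {y} (inj₁-injective (sym same))
  ... | inj₁ y≡x = x≢y (sym y≡x)
  ... | inj₂ (y∈e₀ , x∈e₀) = true≢false (trans (sym (ends-adjacent e₀ x∈e₀ y∈e₀ x≢y)) x≁y)
  tdc .IsTDColouring.proper (inj₁ x) (inj₂ e) _ same = edgeColour≢ e x (sym same)
  tdc .IsTDColouring.proper (inj₂ e) (inj₁ x) _ same = edgeColour≢ e x same
  tdc .IsTDColouring.dominating (inj₁ v) with covers v
  ... | s , v∈εs with edgeColour-cover s
  ...   | t , εs↦t = inj₂ (ε s) , dominated
    where
    dominated : ∀ u → colour u ≡ colour (inj₂ (ε s)) → CAdj G (inj₁ v) u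
    dominated (inj₁ w) same = contradiction (trans same εs↦t) λ ()
    dominated (inj₂ e) same =
      subst (v ∈ₑ_) (trans (sym (edgeColour-inj₂ εs↦t)) (edgeColour-inj₂ (trans same εs↦t))) v∈εs
  tdc .IsTDColouring.dominating (inj₂ e@((x , y) , x<y , _)) with x ∈ₑ? e₀ | y ∈ₑ? e₀
  ... | no x∉e₀ | _ = inj₁ x , end-class (inj₁ refl) (λ x∈e₀ → contradiction x∈e₀ x∉e₀)
  ... | yes _ | no y∉e₀ = inj₁ y , end-class (inj₂ refl) (λ y∈e₀ → contradiction y∈e₀ y∉e₀)
  ... | yes x∈e₀ | yes y∈e₀ =
    inj₁ x , end-class (inj₁ refl) λ _ → edge-unique (<⇒≢ x<y) x∈e₀ y∈e₀ (inj₁ refl) (inj₂ refl)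

central-cover-bound : ∀ {n m k a} {G : Graph n} → HasSize G m → (ε : Fin k → Edge G) →
  (∀ v → ∃ λ t → Edges._∈ₑ_ G v (ε t)) → Edge G → IsTDChromaticNumber (CAdj G) a → a ≤ n + k
central-cover-bound {n} {k = k} {G = G} size ε covers e₀ χ =
  χ≤ (Edges.searchable G size) χ (join n k ∘ colour) (relabel (join-injective n k) tdc)
  where open CoverColouring ε covers e₀

parity : ∀ q → q ≡ ⌊ q /2⌋ + ⌊ q /2⌋ ⊎ q ≡ suc (⌊ q /2⌋ + ⌊ q /2⌋)
parity zero = inj₁ refl
parity (suc zero) = inj₂ refl
parity (suc (suc q)) with parity q
... | inj₁ even = inj₁ (cong suc (trans (cong suc even) (sym (ℕ.+-suc _ _))))
... | inj₂ odd = inj₂ (cong suc (trans (cong suc odd) (cong suc (sym (ℕ.+-suc _ _)))))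

-- On a path with vertices 0, …, m + 1, the t-th covering edge starts at 2t, or at m when 2t > m.
pairStart : ℕ → ℕ → ℕ
pairStart m t = (t + t) ⊓ m

pairStart-covers : ∀ {m q} → q < suc (suc m) → q ≡ pairStart m ⌊ q /2⌋ ⊎ q ≡ suc (pairStart m ⌊ q /2⌋)
pairStart-covers {m} {q} q<2+m with ⌊ q /2⌋ + ⌊ q /2⌋ ℕ.≤? m
... | yes fits = subst (λ b → q ≡ b ⊎ q ≡ suc b) (sym (ℕ.m≤n⇒m⊓n≡m fits)) (parity q)
... | no overflows =
  inj₂ (trans (ℕ.≤-antisym (s≤s⁻¹ q<2+m) (ℕ.≤-trans (ℕ.≰⇒> overflows) (double≤ {⌊ q /2⌋} (parity q))))
              (cong suc (sym (ℕ.m≥n⇒m⊓n≡n (ℕ.<⇒≤ (ℕ.≰⇒> overflows))))))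
  where
  double≤ : ∀ {h} → q ≡ h + h ⊎ q ≡ suc (h + h) → h + h ≤ q
  double≤ (inj₁ refl) = ℕ.≤-refl
  double≤ (inj₂ refl) = ℕ.n≤1+n _

module PathCover {m : ℕ} (G : Graph (suc (suc m))) (path : HamPath G) where

  open Edges G
  open HamiltonianPath G path

  pairStart<m : ∀ t → suc (pairStart m t) < suc (suc m)
  pairStart<m t = s≤s (s≤s (ℕ.m⊓n≤n (t + t) m))

  ε : Fin ⌈ suc (suc m) /2⌉ → Edge G
  ε t = edgeAt (pairStart<m (toℕ t))

  covers : ∀ v → ∃ λ t → v ∈ₑ ε t
  covers v = t , subst (_∈ₑ ε t) (p-position v) (∈-edgeAt {q = position v} (pairStart<m (toℕ t)) in-pair)
    where
    q = toℕ (position v)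
    half<⌈n/2⌉ : ⌊ q /2⌋ < ⌈ suc (suc m) /2⌉
    half<⌈n/2⌉ = ℕ.⌊n/2⌋-mono (s≤s (toℕ<n (position v)))
    t = fromℕ< half<⌈n/2⌉
    in-pair : q ≡ pairStart m (toℕ t) ⊎ q ≡ suc (pairStart m (toℕ t))
    in-pair rewrite toℕ-fromℕ< half<⌈n/2⌉ = pairStart-covers (toℕ<n (position v))

n≤sum : ∀ {n} (f : Fin n → ℕ) → (∀ u → 1 ≤ f u) → n ≤ sum (tabulate f)
n≤sum {zero} f _ = z≤n
n≤sum {suc n} f pos = ℕ.+-mono-≤ (pos zero) (n≤sum (f ∘ suc) (pos ∘ suc))

n≤1+sum : ∀ {n} (f : Fin n → ℕ) v → (∀ u → u ≢ v → 1 ≤ f u) → n ≤ suc (sum (tabulate f))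
n≤1+sum f zero pos = s≤s (ℕ.≤-trans (n≤sum (f ∘ suc) λ u → pos (suc u) λ ()) (ℕ.m≤n+m _ (f zero)))
n≤1+sum f (suc v) pos =
  ℕ.≤-trans (ℕ.+-mono-≤ (pos zero λ ()) (n≤1+sum (f ∘ suc) v λ u u≢v → pos (suc u) (u≢v ∘ suc-injective)))
            (ℕ.≤-reflexive (ℕ.+-suc (f zero) _))

non-neighbour : ∀ {n} (G : Graph n) → 2 ≤ n → MaxDegreeAtMost G (n ∸ 2) → ∀ v → ∃ λ w → v ≢ w × adj G v w ≡ false
non-neighbour {n} G 2≤n Δ v with any? (λ w → ¬? (v ≟ w) ×-dec (adj G v w Bool.≟ false))
... | yes found = found
... | no none = contradiction (ℕ.≤-trans (n≤1+sum indicator v adjacent) (s≤s degree≤)) (n≰1+[n∸2] 2≤n)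
  where
  indicator : Fin n → ℕ
  indicator u = if adj G v u then 1 else 0
  adjacent : ∀ u → u ≢ v → 1 ≤ indicator u
  adjacent u u≢v with adj G v u in v~u
  ... | true = s≤s z≤n
  ... | false = contradiction (u , u≢v ∘ sym , v~u) none
  degree≤ : sum (tabulate indicator) ≤ n ∸ 2
  degree≤ = subst (λ xs → sum xs ≤ n ∸ 2) (map-tabulate (λ u → u) indicator) (Δ v)
  n≰1+[n∸2] : ∀ {n} → 2 ≤ n → ¬ n ≤ suc (n ∸ 2)
  n≰1+[n∸2] (s≤s (s≤s _)) = ℕ.<-irrefl refl ∘ s≤s⁻¹

module NonNeighbourColouring {n : ℕ} {G : Graph n} (non-neighbour : ∀ v → ∃ λ w → v ≢ w × adj G v w ≡ false) where

  colour : CVertex G → Fin n ⊎ Fin 1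
  colour (inj₁ v) = inj₁ v
  colour (inj₂ _) = inj₂ zero

  tdc : IsTDColouring (CAdj G) colour
  tdc .IsTDColouring.proper (inj₁ x) (inj₁ y) (x≢y , _) = x≢y ∘ inj₁-injective
  tdc .IsTDColouring.proper (inj₁ x) (inj₂ e) _ = λ ()
  tdc .IsTDColouring.proper (inj₂ e) (inj₁ x) _ = λ ()
  tdc .IsTDColouring.dominating (inj₁ v) with non-neighbour v
  ... | w , v≢w , v≁w = inj₁ w , λ where
    (inj₁ _) refl → v≢w , v≁w
  tdc .IsTDColouring.dominating (inj₂ e) = inj₁ (proj₁ (proj₁ e)) , λ where
    (inj₁ _) refl → inj₁ refl

central-Δ-bound : ∀ {n m a} {G : Graph n} → HasSize G m → 2 ≤ n → MaxDegreeAtMost G (n ∸ 2) →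
  IsTDChromaticNumber (CAdj G) a → a ≤ n + 1
central-Δ-bound {n} {G = G} size 2≤n Δ χ =
  χ≤ (Edges.searchable G size) χ (join n 1 ∘ colour) (relabel (join-injective n 1) tdc)
  where open NonNeighbourColouring (non-neighbour G 2≤n Δ)

⌊n/2⌋≡n/2 : ∀ n → ⌊ n /2⌋ ≡ n / 2
⌊n/2⌋≡n/2 zero = refl
⌊n/2⌋≡n/2 (suc zero) = refl
⌊n/2⌋≡n/2 (suc (suc n)) = trans (cong suc (⌊n/2⌋≡n/2 n)) (sym (m/n≡1+[m∸n]/n {suc (suc n)} {2} (s≤s (s≤s z≤n))))

⌈n/2⌉≡[n+1]/2 : ∀ n → ⌈ n /2⌉ ≡ (n + 1) / 2
⌈n/2⌉≡[n+1]/2 n = trans (⌊n/2⌋≡n/2 (suc n)) (cong (_/ 2) (ℕ.+-comm 1 n))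

add-bounds : ∀ {a b m n h} → a ≤ n + h → b ≤ m → a + b ≤ m + n + h
add-bounds {a} {b} {m} {n} {h} a≤ b≤ =
  subst (a + b ≤_) (trans (ℕ.+-comm (n + h) m) (sym (ℕ.+-assoc m n h))) (ℕ.+-mono-≤ a≤ b≤)

proposition4p4 : (n m : ℕ) (G : Graph n) →
    4 ≤ n → HasSize G m → n ≤ m → Connected G →
    (a b : ℕ) →
    IsTDChromaticNumber (CAdj G) a →
    IsTDChromaticNumber (Compl (CAdj G)) b →
    HamPath G →
      ((m + 1 + (2 * n) / 3 ≤ a + b) × (a + b ≤ m + n + (n + 1) / 2))
      × (MaxDegreeAtMost G (n ∸ 2) →
          (m + 1 + (2 * n) / 3 ≤ a + b) × (a + b ≤ m + n + 1))
proposition4p4 n@(suc (suc _)) m G (s≤s (s≤s _)) size n≤m _ a b χa χb path =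
  (lower , add-bounds a≤n+⌈n/2⌉ b≤m) , λ Δ → lower , add-bounds (central-Δ-bound size 2≤n Δ χa) b≤m
  where
  2≤n : 2 ≤ n
  2≤n = s≤s (s≤s z≤n)
  e₀ : Edge G
  e₀ = HamiltonianPath.edgeAt G path {0} 2≤n
  b≤m : b ≤ m
  b≤m = complement-upper-bound size path (s≤s z≤n) n≤m χb
  a≤n+⌈n/2⌉ : a ≤ n + (n + 1) / 2
  a≤n+⌈n/2⌉ = subst (λ h → a ≤ n + h) (⌈n/2⌉≡[n+1]/2 n)
                (central-cover-bound size (PathCover.ε G path) (PathCover.covers G path) e₀ χa)
  [2n]/3<a : (2 * n) / 3 < a
  [2n]/3<a = m<n*o⇒m/o<n (subst (suc (2 * n) ≤_) (ℕ.*-comm 3 a) (central-lower-bound path e₀ (proj₁ χa)))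
  lower : m + 1 + (2 * n) / 3 ≤ a + b
  lower = subst₂ _≤_ (sym (ℕ.+-assoc m 1 _)) (ℕ.+-comm b a)
            (ℕ.+-mono-≤ (complement-lower-bound size (proj₁ χb)) [2n]/3<a)
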